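{- Let $(b_1,b_2,\ldots)$ be a non-decreasing sequence of positive integers, and for $m\ge 0$ let $B_m$ be the Ferrers board with $m$ columns having $b_i$ cells in the $i$-th column. Let $R_k(B_m)$ denote the number of ways of placing $k$ non-attacking rooks on $B_m$ (with $R_0(B_m)=1$ and $R_k(B_m)=0$ for $k<0$). Then the matrix $\left[R_{m-k}(B_m)\right]_{m,k\ge 0}$ is totally non-negative.
   Context: A matrix (finite or infinite) is totally non-negative if all its minors (determinants of finite square submatrices) are non-negative. Non-attacking rooks are placed in distinct cells, no two in the same row or column of the board. -}

module Defs where

open import Data.Nat using (ℕ; zero; suc; _≤?_; _∸_)
import Data.Nat as ℕ
open import Data.Nat.Properties using () renaming (_≟_ to _≟ℕ_)
open import Data.Integer using (ℤ; +_; -_; _+_; _*_; _≤_)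
open import Data.Fin using (Fin; zero; suc; punchIn; toℕ) renaming (_<_ to _<ᶠ_)
open import Data.Maybe using (Maybe; just; nothing)
open import Data.List using (List; []; _∷_; map; concatMap; upTo; length; filter; catMaybes)
open import Data.List.Relation.Unary.Unique.DecPropositional _≟ℕ_ using (Unique; unique?)
open import Relation.Nullary.Decidable using (yes; no; _×-dec_)
open import Data.Product using (_×_)

-- Ferrers boards and rook numbers.
-- b : ℕ → ℕ is the sequence of column heights, b 0 = b₁, b 1 = b₂, ...
-- The board B_m consists of cells (i , r) with i < m (column) and
-- r < b i (row).  A placement of non-attacking rooks on B_m is a set
-- of cells, no two in the same column or row; equivalently, a choice
-- for each column i < m of either no rook or a row r < b i, such that
-- the chosen rows are pairwise distinct.

columnOptions : ℕ → List (Maybe ℕ)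
columnOptions h = nothing ∷ map just (upTo h)

-- all assignments (one entry per column, columns 0 .. m-1, listed
-- from column m-1 down to column 0)
assignments : (ℕ → ℕ) → ℕ → List (List (Maybe ℕ))
assignments b zero = [] ∷ []
assignments b (suc m) =
  concatMap (λ a → map (λ o → o ∷ a) (columnOptions (b m))) (assignments b m)

IsRookPlacement : ℕ → List (Maybe ℕ) → Set
IsRookPlacement k a = (length (catMaybes a) ≡ k) × Unique (catMaybes a)
  where open import Relation.Binary.PropositionalEquality using (_≡_)

R : (ℕ → ℕ) → ℕ → ℕ → ℕ
R b m k = length (filter (λ a → (length (catMaybes a) ≟ℕ k) ×-dec unique? (catMaybes a))
                         (assignments b m))

rookMatrix : (ℕ → ℕ) → ℕ → ℕ → ℤ
rookMatrix b m k with k ≤? m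
... | yes _ = + R b m (m ∸ k)
... | no _  = + 0

sumFin : (n : ℕ) → (Fin n → ℤ) → ℤ
sumFin zero    f = + 0
sumFin (suc n) f = f zero + sumFin n (λ i → f (suc i))

altSign : ℕ → ℤ
altSign zero    = + 1
altSign (suc j) = - altSign j

det : (n : ℕ) → (Fin n → Fin n → ℤ) → ℤ
det zero    A = + 1
det (suc n) A =
  sumFin (suc n) (λ j → altSign (toℕ j) * (A zero j * det n (λ r c → A (suc r) (punchIn j c))))

StrictlyIncreasing : {n : ℕ} → (Fin n → ℕ) → Set
StrictlyIncreasing {n} f = ∀ (i j : Fin n) → i <ᶠ j → f i ℕ.< f j

TotallyNonNegative : (ℕ → ℕ → ℤ) → Set
TotallyNonNegative M =
  ∀ (n : ℕ) (rs cs : Fin n → ℕ) → StrictlyIncreasing rs → StrictlyIncreasing cs →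
  + 0 ≤ det n (λ i j → M (rs i) (cs j))

module Submission where

-- Write a_m = b_m - m.  Placing rooks column by column gives the rook
-- recurrence R_{j+1}(B_{m+1}) = R_{j+1}(B_m) + (b_m - j) R_j(B_m), so the
-- matrix is the triangle T_a defined by T_a(0,k) = δ(0,k) and
--   T_a(m+1,k) = T_a(m,k-1) + (a_m + k) T_a(m,k)                  (RookTriangle).
-- For a_0 ≥ 0 and a_{m+1} ≥ a_m - 1 (i.e. b non-decreasing) T_a is totally
-- non-negative (RecursiveTriangle).  The proof deforms the parameter sequence
-- e_m = -m, for which T_e is the identity (Determinant, BoundedMinors), into a
-- by two moves that preserve non-negativity of all minors with rows ≤ N:
-- raising the last relevant parameter e_N, and exchanging adjacent parameters
-- e_p ≤ e_{p+1}.  Each move changes a single row by adding a non-negative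
-- multiple of the previous row, which preserves total non-negativity because
-- the determinant is linear in a row and vanishes on equal adjacent rows.
-- Stage j of the deformation uses a_0, ..., a_{j-1}, c, c - 1, c - 2, ...
-- with c ≤ a_j; from stage j to j + 1 either a_j = c already, or a_j is
-- inserted at position j by raising the last entry and bubbling it forward.

open import Defs

module Determinant where
  open import Data.Nat using (ℕ; zero; suc)
  open import Data.Integer using (ℤ; +_; -_; _+_; _*_)
  import Data.Integer.Properties as ℤP
  open import Data.Integer.Tactic.RingSolver using (solve-∀)
  open import Data.Fin using (Fin; zero; suc; punchIn; punchOut; toℕ; inject₁; _≟_)
  open import Data.Fin.Properties
    using (punchIn-punchOut; punchOut-cong; punchOut-punchIn; punchInᵢ≢i; suc-injective)
  open import Data.Product using (_×_; _,_; proj₁; proj₂)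
  open import Data.Empty using (⊥-elim)
  open import Relation.Nullary using (yes; no; ¬_; Dec)
  open import Relation.Binary.PropositionalEquality
  open ≡-Reasoning

  Matrix : ℕ → Set
  Matrix n = Fin n → Fin n → ℤ

  sign : ∀ {n} → Fin n → ℤ
  sign j = altSign (toℕ j)

  minor : ∀ {n} → Matrix (suc n) → Fin (suc n) → Matrix n
  minor A j r c = A (suc r) (punchIn j c)

  term : ∀ {n} → Matrix (suc n) → Fin (suc n) → ℤ
  term {n} A j = sign j * (A zero j * det n (minor A j))

  sumFin-cong : ∀ n {f g : Fin n → ℤ} → (∀ i → f i ≡ g i) → sumFin n f ≡ sumFin n g
  sumFin-cong zero    e = refl
  sumFin-cong (suc n) e = cong₂ _+_ (e zero) (sumFin-cong n (λ i → e (suc i)))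

  sumFin-+ : ∀ n (f g : Fin n → ℤ) → sumFin n (λ i → f i + g i) ≡ sumFin n f + sumFin n g
  sumFin-+ zero    f g = refl
  sumFin-+ (suc n) f g =
    trans (cong (_+_ (f zero + g zero)) (sumFin-+ n (λ i → f (suc i)) (λ i → g (suc i))))
          (interchange (f zero) (g zero) _ _)
    where
    interchange : ∀ (a b c d : ℤ) → a + b + (c + d) ≡ a + c + (b + d)
    interchange = solve-∀

  sumFin-* : ∀ n (t : ℤ) (f : Fin n → ℤ) → sumFin n (λ i → t * f i) ≡ t * sumFin n f
  sumFin-* zero    t f = sym (ℤP.*-zeroʳ t)
  sumFin-* (suc n) t f = trans (cong (_+_ (t * f zero)) (sumFin-* n t (λ i → f (suc i))))
                               (sym (ℤP.*-distribˡ-+ t (f zero) _))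

  sumFin-neg : ∀ n (f : Fin n → ℤ) → sumFin n (λ i → - f i) ≡ - sumFin n f
  sumFin-neg zero    f = refl
  sumFin-neg (suc n) f = trans (cong (_+_ (- f zero)) (sumFin-neg n (λ i → f (suc i))))
                               (sym (ℤP.neg-distrib-+ (f zero) _))

  sumFin-zero : ∀ n (f : Fin n → ℤ) → (∀ i → f i ≡ + 0) → sumFin n f ≡ + 0
  sumFin-zero zero    f e = refl
  sumFin-zero (suc n) f e = cong₂ _+_ (e zero) (sumFin-zero n (λ i → f (suc i)) (λ i → e (suc i)))

  sumFin-swap : ∀ n m (F : Fin n → Fin m → ℤ) →
    sumFin n (λ i → sumFin m (F i)) ≡ sumFin m (λ j → sumFin n (λ i → F i j))
  sumFin-swap zero    m F = sym (sumFin-zero m _ (λ _ → refl))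
  sumFin-swap (suc n) m F =
    trans (cong (_+_ (sumFin m (F zero))) (sumFin-swap n m (λ i → F (suc i))))
          (sym (sumFin-+ m (F zero) (λ j → sumFin n (λ i → F (suc i) j))))

  sumFin-punchIn : ∀ n (x : Fin (suc n)) (g : Fin (suc n) → ℤ) →
    sumFin (suc n) g ≡ g x + sumFin n (λ l → g (punchIn x l))
  sumFin-punchIn n       zero    g = refl
  sumFin-punchIn (suc n) (suc x) g =
    trans (cong (_+_ (g zero)) (sumFin-punchIn n x (λ i → g (suc i)))) (exchange (g zero) (g (suc x)) _)
    where
    exchange : ∀ (a b c : ℤ) → a + (b + c) ≡ b + (a + c)
    exchange = solve-∀

  det-cong : ∀ n (A B : Matrix n) → (∀ i j → A i j ≡ B i j) → det n A ≡ det n B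
  det-cong zero    A B e = refl
  det-cong (suc n) A B e = sumFin-cong (suc n) λ j →
    cong₂ (λ u v → sign j * (u * v)) (e zero j) (det-cong n _ _ (λ r c → e (suc r) (punchIn j c)))

  det-by-terms : ∀ n (A B C : Matrix (suc n)) (t : ℤ) →
    (∀ j → term A j ≡ term B j + t * term C j) → det (suc n) A ≡ det (suc n) B + t * det (suc n) C
  det-by-terms n A B C t h = begin
    det (suc n) A                                         ≡⟨ sumFin-cong (suc n) h ⟩
    sumFin (suc n) (λ j → term B j + t * term C j)        ≡⟨ sumFin-+ (suc n) (term B) (λ j → t * term C j) ⟩
    det (suc n) B + sumFin (suc n) (λ j → t * term C j)   ≡⟨ cong (_+_ (det (suc n) B)) (sumFin-* (suc n) t (term C)) ⟩
    det (suc n) B + t * det (suc n) C                     ∎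

  det-linear-row : ∀ n (A B C : Matrix n) (p : Fin n) (t : ℤ) →
    (∀ i → ¬ i ≡ p → ∀ j → B i j ≡ A i j) → (∀ i → ¬ i ≡ p → ∀ j → C i j ≡ A i j) →
    (∀ j → A p j ≡ B p j + t * C p j) → det n A ≡ det n B + t * det n C
  det-linear-row (suc n) A B C zero t offB offC rowA = det-by-terms n A B C t split
    where
    distrib : ∀ (s b c t d : ℤ) → s * ((b + t * c) * d) ≡ s * (b * d) + t * (s * (c * d))
    distrib = solve-∀
    split : ∀ j → term A j ≡ term B j + t * term C j
    split j = begin
      sign j * (A zero j * det n (minor A j))
        ≡⟨ cong (λ x → sign j * (x * det n (minor A j))) (rowA j) ⟩
      sign j * ((B zero j + t * C zero j) * det n (minor A j))
        ≡⟨ distrib (sign j) (B zero j) (C zero j) t _ ⟩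
      sign j * (B zero j * det n (minor A j)) + t * (sign j * (C zero j * det n (minor A j)))
        ≡⟨ cong₂ (λ d d′ → sign j * (B zero j * d) + t * (sign j * (C zero j * d′)))
                 (det-cong n _ _ λ r c → sym (offB (suc r) (λ ()) _))
                 (det-cong n _ _ λ r c → sym (offC (suc r) (λ ()) _)) ⟩
      term B j + t * term C j ∎
  det-linear-row (suc n) A B C (suc p) t offB offC rowA = det-by-terms n A B C t split
    where
    distrib : ∀ (s a b c t : ℤ) → s * (a * (b + t * c)) ≡ s * (a * b) + t * (s * (a * c))
    distrib = solve-∀
    off : ∀ {X : Matrix (suc n)} → (∀ i → ¬ i ≡ suc p → ∀ j → X i j ≡ A i j) →
          ∀ i → ¬ i ≡ p → ∀ j → X (suc i) j ≡ A (suc i) j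
    off offX i i≢p = offX (suc i) (λ e → i≢p (suc-injective e))
    split : ∀ j → term A j ≡ term B j + t * term C j
    split j = begin
      sign j * (A zero j * det n (minor A j))
        ≡⟨ cong (λ d → sign j * (A zero j * d))
                (det-linear-row n _ _ _ p t (λ i i≢p c → off offB i i≢p _)
                                            (λ i i≢p c → off offC i i≢p _) (λ c → rowA _)) ⟩
      sign j * (A zero j * (det n (minor B j) + t * det n (minor C j)))
        ≡⟨ distrib (sign j) (A zero j) _ _ t ⟩
      sign j * (A zero j * det n (minor B j)) + t * (sign j * (A zero j * det n (minor C j)))
        ≡⟨ cong₂ (λ x y → sign j * (x * det n (minor B j)) + t * (sign j * (y * det n (minor C j))))
                 (sym (offB zero (λ ()) j)) (sym (offC zero (λ ()) j)) ⟩
      term B j + t * term C j ∎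

  det-zero-column : ∀ n (A : Matrix n) (c : Fin n) → (∀ i → A i c ≡ + 0) → det n A ≡ + 0
  det-zero-column (suc n) A c zeroCol = sumFin-zero (suc n) (term A) λ j → vanish j (j ≟ c)
    where
    vanish : ∀ j → Dec (j ≡ c) → term A j ≡ + 0
    vanish j (yes refl) = begin
      sign j * (A zero j * det n (minor A j)) ≡⟨ cong (λ x → sign j * (x * det n (minor A j))) (zeroCol zero) ⟩
      sign j * (+ 0 * det n (minor A j))      ≡⟨ ℤP.*-zeroʳ (sign j) ⟩
      + 0                                     ∎
    vanish j (no j≢c) = begin
      sign j * (A zero j * det n (minor A j))
        ≡⟨ cong (λ d → sign j * (A zero j * d))
                (det-zero-column n (minor A j) (punchOut j≢c)
                   (λ r → trans (cong (A (suc r)) (punchIn-punchOut j≢c)) (zeroCol (suc r)))) ⟩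
      sign j * (A zero j * + 0)   ≡⟨ cong (sign j *_) (ℤP.*-zeroʳ (A zero j)) ⟩
      sign j * + 0                ≡⟨ ℤP.*-zeroʳ (sign j) ⟩
      + 0                         ∎

  punchOut-swap : ∀ {n} (x y : Fin (suc (suc n))) (x≢y : ¬ x ≡ y) (y≢x : ¬ y ≡ x) →
    (sign x * sign (punchOut x≢y) ≡ - (sign y * sign (punchOut y≢x))) ×
    (∀ c → punchIn x (punchIn (punchOut x≢y) c) ≡ punchIn y (punchIn (punchOut y≢x) c))
  punchOut-swap zero    zero    x≢y y≢x = ⊥-elim (x≢y refl)
  punchOut-swap zero    (suc y) x≢y y≢x = flip (sign y) , λ c → refl
    where
    flip : ∀ a → + 1 * a ≡ - (- a * + 1)
    flip = solve-∀
  punchOut-swap (suc x) zero    x≢y y≢x = flip (sign x) , λ c → refl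
    where
    flip : ∀ a → - a * + 1 ≡ - (+ 1 * a)
    flip = solve-∀
  punchOut-swap {zero}  (suc zero) (suc zero) x≢y y≢x = ⊥-elim (x≢y refl)
  punchOut-swap {suc n} (suc x) (suc y) x≢y y≢x =
    trans (neg-neg (sign x) _) (trans (proj₁ ih) (cong -_ (sym (neg-neg (sign y) _)))) ,
    λ { zero → refl ; (suc c) → cong suc (proj₂ ih c) }
    where
    ih = punchOut-swap x y (λ e → x≢y (cong suc e)) (λ e → y≢x (cong suc e))
    neg-neg : ∀ (a b : ℤ) → (- a) * (- b) ≡ a * b
    neg-neg = solve-∀

  self-negation-zero : ∀ (s : ℤ) → s ≡ - s → s ≡ + 0
  self-negation-zero (+ zero)   _  = refl
  self-negation-zero (+ suc n)  ()
  self-negation-zero (ℤ.negsuc n) ()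

  -- Expanding
  -- along both rows writes det A as a double sum over ordered pairs of
  -- distinct columns whose summand is antisymmetric in the pair.
  det-equal-first-rows : ∀ n (A : Matrix (suc (suc n))) → (∀ j → A zero j ≡ A (suc zero) j) →
    det (suc (suc n)) A ≡ + 0
  det-equal-first-rows n A rows = trans expand (self-negation-zero S S≡-S)
    where
    N = suc (suc n)
    D : Fin N → Fin (suc n) → ℤ
    D x l = det n (λ r c → A (suc (suc r)) (punchIn x (punchIn l c)))
    term₂ : Fin N → Fin (suc n) → ℤ
    term₂ x l = sign x * (A zero x * (sign l * (A (suc zero) (punchIn x l) * D x l)))
    pairTerm : (x y : Fin N) → Dec (x ≡ y) → ℤ
    pairTerm x y (yes _)  = + 0
    pairTerm x y (no x≢y) = term₂ x (punchOut x≢y)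
    F : Fin N → Fin N → ℤ
    F x y = pairTerm x y (x ≟ y)
    S = sumFin N (λ x → sumFin N (F x))

    F-diagonal : ∀ x → F x x ≡ + 0
    F-diagonal x with x ≟ x
    ... | yes _  = refl
    ... | no x≢x = ⊥-elim (x≢x refl)
    F-punchIn : ∀ x l → F x (punchIn x l) ≡ term₂ x l
    F-punchIn x l with x ≟ punchIn x l
    ... | yes e  = ⊥-elim (punchInᵢ≢i x l (sym e))
    ... | no x≢y = cong (term₂ x) (trans (punchOut-cong x refl) (punchOut-punchIn x))
    row-sum : ∀ x → term A x ≡ sumFin N (F x)
    row-sum x = begin
      sign x * (A zero x * det (suc n) (minor A x))
        ≡⟨ cong (sign x *_) (sym (sumFin-* (suc n) (A zero x) (λ l → sign l * (A (suc zero) (punchIn x l) * D x l)))) ⟩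
      sign x * sumFin (suc n) (λ l → A zero x * (sign l * (A (suc zero) (punchIn x l) * D x l)))
        ≡⟨ sym (sumFin-* (suc n) (sign x) (λ l → A zero x * (sign l * (A (suc zero) (punchIn x l) * D x l)))) ⟩
      sumFin (suc n) (term₂ x)
        ≡⟨ sym (trans (sumFin-punchIn (suc n) x (F x))
                      (trans (cong₂ _+_ (F-diagonal x) (sumFin-cong (suc n) (F-punchIn x)))
                             (ℤP.+-identityˡ _))) ⟩
      sumFin N (F x) ∎
    expand : det N A ≡ S
    expand = sumFin-cong N row-sum

    regroup : ∀ (sx sp sy sq a b d : ℤ) → sx * sp ≡ - (sy * sq) →
              sx * (a * (sp * (b * d))) ≡ - (sy * (b * (sq * (a * d))))
    regroup sx sp sy sq a b d h = trans (gather sx sp a b d)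
      (trans (cong (λ w → w * (a * b * d)) h) (scatter sy sq a b d))
      where
      gather : ∀ sx sp a b d → sx * (a * (sp * (b * d))) ≡ (sx * sp) * (a * b * d)
      gather = solve-∀
      scatter : ∀ sy sq a b d → - (sy * sq) * (a * b * d) ≡ - (sy * (b * (sq * (a * d))))
      scatter = solve-∀
    -- uses that rows 0 and 1 agree: the pair (x , y) and (y , x) cancel
    F-antisym : ∀ x y → F x y ≡ - F y x
    F-antisym x y with x ≟ y | y ≟ x
    ... | yes _   | yes _   = refl
    ... | yes x≡y | no y≢x  = ⊥-elim (y≢x (sym x≡y))
    ... | no x≢y  | yes y≡x = ⊥-elim (x≢y (sym y≡x))
    ... | no x≢y  | no y≢x  = begin
      sign x * (A zero x * (sign p * (A (suc zero) (punchIn x p) * D x p)))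
        ≡⟨ cong (λ w → sign x * (A zero x * (sign p * w)))
                (cong₂ _*_ (trans (cong (A (suc zero)) (punchIn-punchOut x≢y)) (sym (rows y)))
                           (det-cong n _ _ λ r c → cong (A (suc (suc r))) (proj₂ swap c))) ⟩
      sign x * (A zero x * (sign p * (A zero y * D y q)))
        ≡⟨ regroup (sign x) (sign p) (sign y) (sign q) (A zero x) (A zero y) (D y q) (proj₁ swap) ⟩
      - (sign y * (A zero y * (sign q * (A zero x * D y q))))
        ≡⟨ cong (λ w → - (sign y * (A zero y * (sign q * (w * D y q)))))
                (trans (rows x) (cong (A (suc zero)) (sym (punchIn-punchOut y≢x)))) ⟩
      - (sign y * (A zero y * (sign q * (A (suc zero) (punchIn y q) * D y q)))) ∎
      where
      p = punchOut x≢y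
      q = punchOut y≢x
      swap = punchOut-swap x y x≢y y≢x
    S≡-S : S ≡ - S
    S≡-S = begin
      S                                          ≡⟨ sumFin-swap N N F ⟩
      sumFin N (λ y → sumFin N (λ x → F x y))    ≡⟨ sumFin-cong N (λ y → sumFin-cong N (λ x → F-antisym x y)) ⟩
      sumFin N (λ y → sumFin N (λ x → - F y x))  ≡⟨ sumFin-cong N (λ y → sumFin-neg N (F y)) ⟩
      sumFin N (λ y → - sumFin N (F y))          ≡⟨ sumFin-neg N (λ y → sumFin N (F y)) ⟩
      - S                                        ∎

  det-equal-adjacent-rows : ∀ n (A : Matrix (suc n)) (p : Fin n) →
    (∀ j → A (inject₁ p) j ≡ A (suc p) j) → det (suc n) A ≡ + 0
  det-equal-adjacent-rows (suc n) A zero    rows = det-equal-first-rows n A rows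
  det-equal-adjacent-rows (suc n) A (suc p) rows = sumFin-zero (suc (suc n)) (term A) λ j → begin
    sign j * (A zero j * det (suc n) (minor A j))
      ≡⟨ cong (λ d → sign j * (A zero j * d)) (det-equal-adjacent-rows n (minor A j) p (λ c → rows _)) ⟩
    sign j * (A zero j * + 0)  ≡⟨ cong (sign j *_) (ℤP.*-zeroʳ (A zero j)) ⟩
    sign j * + 0               ≡⟨ ℤP.*-zeroʳ (sign j) ⟩
    + 0                        ∎

  det-zero-first-row : ∀ n (A : Matrix (suc n)) → (∀ j → A zero j ≡ + 0) → det (suc n) A ≡ + 0
  det-zero-first-row n A zeroRow = sumFin-zero (suc n) (term A) λ j → begin
    sign j * (A zero j * det n (minor A j)) ≡⟨ cong (λ x → sign j * (x * det n (minor A j))) (zeroRow j) ⟩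
    sign j * (+ 0 * det n (minor A j))      ≡⟨ ℤP.*-zeroʳ (sign j) ⟩
    + 0                                     ∎

  det-unit-first-row : ∀ n (A : Matrix (suc n)) → A zero zero ≡ + 1 → (∀ j → A zero (suc j) ≡ + 0) →
    det (suc n) A ≡ det n (λ r c → A (suc r) (suc c))
  det-unit-first-row n A corner rest = begin
    term A zero + sumFin n (λ j → term A (suc j))
      ≡⟨ cong₂ _+_ (cong (λ x → + 1 * (x * det n (minor A zero))) corner)
                   (sumFin-zero n (λ j → term A (suc j)) λ j →
                     trans (cong (λ x → sign (suc j) * (x * det n (minor A (suc j)))) (rest j))
                           (ℤP.*-zeroʳ (sign (suc j)))) ⟩
    + 1 * (+ 1 * det n (minor A zero)) + + 0
      ≡⟨ unit (det n (minor A zero)) ⟩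
    det n (λ r c → A (suc r) (suc c)) ∎
    where
    unit : ∀ d → + 1 * (+ 1 * d) + + 0 ≡ d
    unit = solve-∀

module BoundedMinors where
  open Determinant
  open import Data.Nat using (ℕ; zero; suc; z≤n; s≤s) renaming (_≤_ to _≤ℕ_; _<_ to _<ℕ_)
  import Data.Nat as ℕ
  import Data.Nat.Properties as ℕP
  open import Data.Integer using (ℤ; +_; _+_; _*_; _≤_; +≤+)
  import Data.Integer.Properties as ℤP
  open import Data.Fin using (Fin; zero; suc; toℕ; inject₁; _≟_)
  import Data.Fin.Properties as FP
  open import Data.Vec.Functional using (updateAt)
  open import Data.Vec.Functional.Properties using (updateAt-updates; updateAt-minimal)
  open import Data.Product using (_,_)
  open import Data.Sum using (inj₁; inj₂)
  open import Data.Empty using (⊥-elim)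
  open import Relation.Nullary using (yes; no; ¬_)
  open import Relation.Binary.Definitions using (tri<; tri≈; tri>)
  open import Relation.Binary.PropositionalEquality

  increasing-mono : ∀ {n} (f : Fin n → ℕ) → StrictlyIncreasing f →
    ∀ i j → toℕ i ≤ℕ toℕ j → f i ≤ℕ f j
  increasing-mono f inc i j i≤j with ℕP.m≤n⇒m<n∨m≡n i≤j
  ... | inj₁ i<j = ℕP.<⇒≤ (inc i j i<j)
  ... | inj₂ i≡j = ℕP.≤-reflexive (cong f (FP.toℕ-injective i≡j))

  increasing-injective : ∀ {n} (f : Fin n → ℕ) → StrictlyIncreasing f → ∀ i j → f i ≡ f j → i ≡ j
  increasing-injective f inc i j eq with ℕP.<-cmp (toℕ i) (toℕ j)
  ... | tri< i<j _ _ = ⊥-elim (ℕP.<⇒≢ (inc i j i<j) eq)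
  ... | tri≈ _ i≡j _ = FP.toℕ-injective i≡j
  ... | tri> _ _ j<i = ⊥-elim (ℕP.<⇒≢ (inc j i j<i) (sym eq))

  TNUpTo : ℕ → (ℕ → ℕ → ℤ) → Set
  TNUpTo N M = ∀ n (rs cs : Fin n → ℕ) → StrictlyIncreasing rs → StrictlyIncreasing cs →
    (∀ i → rs i ≤ℕ N) → + 0 ≤ det n (λ i j → M (rs i) (cs j))

  sumIndices : ∀ n → (Fin n → ℕ) → ℕ
  sumIndices zero    f = 0
  sumIndices (suc n) f = f zero ℕ.+ sumIndices n (λ i → f (suc i))

  index≤sum : ∀ n (f : Fin n → ℕ) i → f i ≤ℕ sumIndices n f
  index≤sum (suc n) f zero    = ℕP.m≤m+n _ _
  index≤sum (suc n) f (suc i) = ℕP.≤-trans (index≤sum n (λ i → f (suc i)) i) (ℕP.m≤n+m _ _)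

  TN-cong : ∀ M M′ → (∀ m k → M m k ≡ M′ m k) → TotallyNonNegative M → TotallyNonNegative M′
  TN-cong M M′ M≗M′ tn n rs cs rsInc csInc =
    subst (+ 0 ≤_) (det-cong n _ _ λ i j → M≗M′ (rs i) (cs j)) (tn n rs cs rsInc csInc)

  -- Every minor has its rows bounded by some N, so it suffices to consider
  -- each row-bounded part.
  TN-from-bounded : ∀ M → (∀ N → TNUpTo (suc N) M) → TotallyNonNegative M
  TN-from-bounded M tn n rs cs rsInc csInc =
    tn (sumIndices n rs) n rs cs rsInc csInc (λ i → ℕP.m≤n⇒m≤1+n (index≤sum n rs i))

  δ : ℕ → ℕ → ℤ
  δ zero    zero    = + 1
  δ zero    (suc k) = + 0
  δ (suc m) zero    = + 0
  δ (suc m) (suc k) = δ m k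

  δ-off : ∀ {m k} → ¬ m ≡ k → δ m k ≡ + 0
  δ-off {zero}  {zero}  0≢0 = ⊥-elim (0≢0 refl)
  δ-off {zero}  {suc k} _   = refl
  δ-off {suc m} {zero}  _   = refl
  δ-off {suc m} {suc k} m≢k = δ-off (λ e → m≢k (cong suc e))

  δ-diag : ∀ m → δ m m ≡ + 1
  δ-diag zero    = refl
  δ-diag (suc m) = δ-diag m

  -- Every minor of the identity matrix is 0 or 1.  Compare the first row
  -- index r and column index c: if r < c the first row vanishes, if r > c
  -- the first column does, and if r = c the minor reduces to a smaller one.
  identity-TN : TotallyNonNegative δ
  identity-TN zero    rs cs rsInc csInc = +≤+ z≤n
  identity-TN (suc n) rs cs rsInc csInc with ℕP.<-cmp (rs zero) (cs zero)
  ... | tri< r<c _ _ = ℤP.≤-reflexive (sym (det-zero-first-row n (λ i j → δ (rs i) (cs j)) λ j →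
        δ-off (ℕP.<⇒≢ (ℕP.<-≤-trans r<c (increasing-mono cs csInc zero j z≤n)))))
  ... | tri> _ _ c<r = ℤP.≤-reflexive (sym (det-zero-column (suc n) (λ i j → δ (rs i) (cs j)) zero λ i →
        δ-off (λ e → ℕP.<⇒≢ (ℕP.<-≤-trans c<r (increasing-mono rs rsInc zero i z≤n)) (sym e))))
  ... | tri≈ _ r≡c _ = subst (+ 0 ≤_) (sym reduce)
        (identity-TN n (λ i → rs (suc i)) (λ i → cs (suc i))
                     (λ i j i<j → rsInc (suc i) (suc j) (s≤s i<j)) (λ i j i<j → csInc (suc i) (suc j) (s≤s i<j)))
    where
    reduce : det (suc n) (λ i j → δ (rs i) (cs j)) ≡ det n (λ i j → δ (rs (suc i)) (cs (suc j)))
    reduce = det-unit-first-row n (λ i j → δ (rs i) (cs j)) (trans (cong (δ (rs zero)) (sym r≡c)) (δ-diag (rs zero)))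
      (λ j → δ-off (λ e → ℕP.<⇒≢ (subst (_<ℕ cs (suc j)) (sym r≡c) (csInc zero (suc j) (s≤s z≤n))) e))

  update-increasing : ∀ {n} (f : Fin n → ℕ) p v → StrictlyIncreasing f →
    (∀ i → toℕ i <ℕ toℕ p → f i <ℕ v) → (∀ j → toℕ p <ℕ toℕ j → v <ℕ f j) →
    StrictlyIncreasing (updateAt f p (λ _ → v))
  update-increasing f p v inc below above i j i<j with i ≟ p | j ≟ p
  ... | yes refl | yes refl = ⊥-elim (ℕP.<-irrefl refl i<j)
  ... | yes refl | no j≢p   = subst₂ _<ℕ_ (sym (updateAt-updates p f)) (sym (updateAt-minimal j p f j≢p)) (above j i<j)
  ... | no i≢p   | yes refl = subst₂ _<ℕ_ (sym (updateAt-minimal i p f i≢p)) (sym (updateAt-updates p f)) (below i i<j)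
  ... | no i≢p   | no j≢p   =
    subst₂ _<ℕ_ (sym (updateAt-minimal i p f i≢p)) (sym (updateAt-minimal j p f j≢p)) (inc i j i<j)

  lowered-bounded : ∀ N {n} (rs : Fin n → ℕ) q p → (∀ i → rs i ≤ℕ N) → rs p ≡ suc q →
    ∀ i → updateAt rs p (λ _ → q) i ≤ℕ N
  lowered-bounded N rs q p bound rp i with i ≟ p
  ... | yes refl = subst (_≤ℕ N) (sym (updateAt-updates p rs)) (ℕP.<⇒≤ (subst (_≤ℕ N) rp (bound p)))
  ... | no i≢p   = subst (_≤ℕ N) (sym (updateAt-minimal i p rs i≢p)) (bound i)

  above-lowered : ∀ {n} (rs : Fin n → ℕ) q p → StrictlyIncreasing rs → rs p ≡ suc q →
    ∀ j → toℕ p <ℕ toℕ j → q <ℕ rs j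
  above-lowered rs q p inc rp j p<j = ℕP.<-trans (ℕP.n<1+n q) (subst (_<ℕ rs j) rp (inc p j p<j))

  -- Minors of M whose row sequence contains q + 1 and is modified by
  -- replacing q + 1 by q are non-negative: either q already occurs just
  -- before (two equal adjacent rows), or the new sequence is increasing.
  lowered-minor-nonneg : ∀ N (M : ℕ → ℕ → ℤ) q → TNUpTo N M →
    ∀ n (rs cs : Fin n → ℕ) → StrictlyIncreasing rs → StrictlyIncreasing cs →
    (∀ i → rs i ≤ℕ N) → (p : Fin n) → rs p ≡ suc q →
    + 0 ≤ det n (λ i j → M (updateAt rs p (λ _ → q) i) (cs j))
  lowered-minor-nonneg N M q tn (suc n) rs cs rsInc csInc bound zero rp =
    tn (suc n) _ cs (update-increasing rs zero q rsInc (λ i ()) (above-lowered rs q zero rsInc rp))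
       csInc (lowered-bounded N rs q zero bound rp)
  lowered-minor-nonneg N M q tn (suc (suc n)) rs cs rsInc csInc bound (suc p) rp
    with ℕP.m≤n⇒m<n∨m≡n (ℕP.≤-pred previous<)
    where
    previous< : rs (inject₁ p) <ℕ suc q
    previous< = subst (rs (inject₁ p) <ℕ_) rp
      (rsInc (inject₁ p) (suc p) (subst (_<ℕ suc (toℕ p)) (sym (FP.toℕ-inject₁ p)) (ℕP.n<1+n _)))
  ... | inj₁ previous<q =
    tn _ _ cs (update-increasing rs (suc p) q rsInc below (above-lowered rs q (suc p) rsInc rp))
       csInc (lowered-bounded N rs q (suc p) bound rp)
    where
    below : ∀ i → toℕ i <ℕ suc (toℕ p) → rs i <ℕ q
    below i i<p = ℕP.≤-<-trans
      (increasing-mono rs rsInc i (inject₁ p) (subst (toℕ i ≤ℕ_) (sym (FP.toℕ-inject₁ p)) (ℕP.≤-pred i<p)))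
      previous<q
  ... | inj₂ previous≡q = ℤP.≤-reflexive (sym (det-equal-adjacent-rows (suc n) lowered p λ j →
          cong (λ r → M r (cs j))
               (trans (updateAt-minimal (inject₁ p) (suc p) rs inject≢suc)
                      (trans previous≡q (sym (updateAt-updates (suc p) rs))))))
    where
    lowered : Matrix (suc (suc n))
    lowered i j = M (updateAt rs (suc p) (λ _ → q) i) (cs j)
    inject≢suc : ¬ inject₁ p ≡ suc p
    inject≢suc e = ℕP.<-irrefl (trans (sym (FP.toℕ-inject₁ p)) (cong toℕ e)) (ℕP.n<1+n (toℕ p))

  -- Adding a non-negative multiple of row q to row q + 1 preserves total
  -- non-negativity of the rows up to N (by linearity of det in that row).
  add-row-multiple : ∀ N (M M′ : ℕ → ℕ → ℤ) q (t : ℕ) →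
    (∀ m → m ≤ℕ N → ¬ m ≡ suc q → ∀ k → M′ m k ≡ M m k) →
    (∀ k → M′ (suc q) k ≡ M (suc q) k + + t * M q k) → TNUpTo N M → TNUpTo N M′
  add-row-multiple N M M′ q t same changed tn n rs cs rsInc csInc bound
    with FP.any? (λ p → rs p ℕP.≟ suc q)
  ... | no absent = subst (+ 0 ≤_)
        (det-cong n _ _ λ i j → sym (same (rs i) (bound i) (λ e → absent (i , e)) (cs j)))
        (tn n rs cs rsInc csInc bound)
  ... | yes (p , rp) = subst (+ 0 ≤_) (sym split)
        (nonneg-combination (tn n rs cs rsInc csInc bound)
                            (lowered-minor-nonneg N M q tn n rs cs rsInc csInc bound p rp))
    where
    nonneg-combination : ∀ {a b : ℤ} → + 0 ≤ a → + 0 ≤ b → + 0 ≤ a + + t * b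
    nonneg-combination {+ a} {+ b} _ _ = subst (+ 0 ≤_)
      (trans (ℤP.pos-+ a (t ℕ.* b)) (cong (_+_ (+ a)) (ℤP.pos-* t b))) (+≤+ z≤n)
    lowered : Fin n → ℕ
    lowered = updateAt rs p (λ _ → q)
    other : ∀ i → ¬ i ≡ p → ¬ rs i ≡ suc q
    other i i≢p e = i≢p (increasing-injective rs rsInc i p (trans e (sym rp)))
    split : det n (λ i j → M′ (rs i) (cs j)) ≡
            det n (λ i j → M (rs i) (cs j)) + + t * det n (λ i j → M (lowered i) (cs j))
    split = det-linear-row n _ _ _ p (+ t)
      (λ i i≢p j → sym (same (rs i) (bound i) (other i i≢p) (cs j)))
      (λ i i≢p j → trans (cong (λ r → M r (cs j)) (updateAt-minimal i p rs i≢p))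
                         (sym (same (rs i) (bound i) (other i i≢p) (cs j))))
      (λ j → trans (cong (λ r → M′ r (cs j)) rp)
        (trans (changed (cs j))
               (cong₂ (λ u v → M u (cs j) + + t * M v (cs j)) (sym rp) (sym (updateAt-updates p rs)))))

module RecursiveTriangle where
  open Determinant
  open BoundedMinors
  open import Data.Nat using (ℕ; zero; suc; z≤n; s≤s; _∸_) renaming (_≤_ to _≤ℕ_; _<_ to _<ℕ_)
  import Data.Nat as ℕ
  import Data.Nat.Properties as ℕP
  open import Data.Integer using (ℤ; +_; _+_; _*_; _-_; _≤_; ∣_∣)
  import Data.Integer.Properties as ℤP
  open import Data.Integer.Tactic.RingSolver using (solve-∀)
  open import Data.Product using (Σ; _×_; _,_)
  open import Data.Empty using (⊥-elim)
  open import Relation.Nullary using (yes; no; ¬_)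
  open import Relation.Binary.Definitions using (Tri; tri<; tri≈; tri>)
  open import Relation.Binary.PropositionalEquality
  open ≡-Reasoning

  shift : (ℕ → ℤ) → ℕ → ℤ
  shift f zero    = + 0
  shift f (suc k) = f k

  nextRow : ℤ → (ℕ → ℤ) → ℕ → ℤ
  nextRow x f k = shift f k + (x + + k) * f k

  triangle : (ℕ → ℤ) → ℕ → ℕ → ℤ
  triangle e zero    k = δ zero k
  triangle e (suc m) k = nextRow (e m) (triangle e m) k

  nextRow-cong : ∀ {x y f g} → x ≡ y → (∀ k → f k ≡ g k) → ∀ k → nextRow x f k ≡ nextRow y g k
  nextRow-cong {x} {f = f} {g} refl f≗g k = cong₂ (λ s r → s + (x + + k) * r) (shift-cong k) (f≗g k)
    where
    shift-cong : ∀ k → shift f k ≡ shift g k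
    shift-cong zero    = refl
    shift-cong (suc k) = f≗g k

  -- Two steps of the recurrence commute, so T_e(m+2) is symmetric in e_m, e_{m+1}.
  nextRow-commute : ∀ x y f k → nextRow y (nextRow x f) k ≡ nextRow x (nextRow y f) k
  nextRow-commute x y f zero    = ring₀ x y (f zero)
    where
    ring₀ : ∀ x y a → + 0 + (y + + 0) * (+ 0 + (x + + 0) * a) ≡ + 0 + (x + + 0) * (+ 0 + (y + + 0) * a)
    ring₀ = solve-∀
  nextRow-commute x y f (suc k) = ring₁ x y (+ k) (shift f k) (f k) (f (suc k))
    where
    ring₁ : ∀ x y k s a b →
      (s + (x + k) * a) + (y + (+ 1 + k)) * (a + (x + (+ 1 + k)) * b) ≡
      (s + (y + k) * a) + (x + (+ 1 + k)) * (a + (y + (+ 1 + k)) * b)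
    ring₁ = solve-∀

  RowsAgree : (ℕ → ℤ) → (ℕ → ℤ) → ℕ → Set
  RowsAgree e e′ m = ∀ k → triangle e m k ≡ triangle e′ m k

  triangle-prefix : ∀ e e′ m → (∀ i → i <ℕ m → e i ≡ e′ i) → RowsAgree e e′ m
  triangle-prefix e e′ zero    same k = refl
  triangle-prefix e e′ (suc m) same =
    nextRow-cong (same m (ℕP.n<1+n m)) (triangle-prefix e e′ m (λ i i<m → same i (ℕP.m<n⇒m<1+n i<m)))

  triangle-suffix : ∀ e e′ r → RowsAgree e e′ r → (∀ i → r ≤ℕ i → e i ≡ e′ i) →
    ∀ d → RowsAgree e e′ (d ℕ.+ r)
  triangle-suffix e e′ r rows same zero    = rows
  triangle-suffix e e′ r rows same (suc d) =
    nextRow-cong (same (d ℕ.+ r) (ℕP.m≤n+m r d)) (triangle-suffix e e′ r rows same d)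

  TN-prefix : ∀ N e e′ → (∀ i → i <ℕ N → e i ≡ e′ i) →
    TNUpTo N (triangle e) → TNUpTo N (triangle e′)
  TN-prefix N e e′ same tn n rs cs rsInc csInc bound = subst (+ 0 ≤_)
    (det-cong n _ _ λ i j → triangle-prefix e e′ (rs i) (λ l l<r → same l (ℕP.<-≤-trans l<r (bound i))) (cs j))
    (tn n rs cs rsInc csInc bound)

  raise-next-row : ∀ e e′ p (t : ℕ) → (∀ i → i <ℕ p → e′ i ≡ e i) → e′ p ≡ e p + + t →
    ∀ k → triangle e′ (suc p) k ≡ triangle e (suc p) k + + t * triangle e p k
  raise-next-row e e′ p t same raised k = begin
    nextRow (e′ p) (triangle e′ p) k  ≡⟨ nextRow-cong raised (triangle-prefix e′ e p same) k ⟩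
    nextRow (e p + + t) X k           ≡⟨ regroup (shift X k) (e p) (+ k) (+ t) (X k) ⟩
    nextRow (e p) X k + + t * X k     ∎
    where
    X : ℕ → ℤ
    X = triangle e p
    regroup : ∀ s x k t r → s + ((x + t) + k) * r ≡ (s + (x + k) * r) + t * r
    regroup = solve-∀

  TN-raise-last : ∀ N e e′ (t : ℕ) → (∀ i → i <ℕ N → e′ i ≡ e i) → e′ N ≡ e N + + t →
    TNUpTo (suc N) (triangle e) → TNUpTo (suc N) (triangle e′)
  TN-raise-last N e e′ t same raised =
    add-row-multiple (suc N) (triangle e) (triangle e′) N t unchanged (raise-next-row e e′ N t same raised)
    where
    unchanged : ∀ m → m ≤ℕ suc N → ¬ m ≡ suc N → RowsAgree e′ e m
    unchanged m m≤ m≢ = triangle-prefix e′ e m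
      (λ i i<m → same i (ℕP.<-≤-trans i<m (ℕP.≤-pred (ℕP.≤∧≢⇒< m≤ m≢))))

  -- Exchanging adjacent parameters e_p ≤ e_{p+1} (so that the larger one
  -- comes first) preserves total non-negativity: rows other than p + 1 do
  -- not change, and row p + 1 gains (e_{p+1} - e_p) times row p.
  TN-swap-adjacent : ∀ N e e′ p (t : ℕ) →
    (∀ i → i <ℕ p → e′ i ≡ e i) → e′ p ≡ e (suc p) → e′ (suc p) ≡ e p →
    (∀ i → suc (suc p) ≤ℕ i → e′ i ≡ e i) → e (suc p) ≡ e p + + t →
    TNUpTo N (triangle e) → TNUpTo N (triangle e′)
  TN-swap-adjacent N e e′ p t below swap₀ swap₁ above larger =
    add-row-multiple N (triangle e) (triangle e′) p t (λ m _ → unchanged m)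
      (raise-next-row e e′ p t below (trans swap₀ larger))
    where
    prefix : RowsAgree e′ e p
    prefix = triangle-prefix e′ e p below
    after-swap : RowsAgree e′ e (suc (suc p))
    after-swap k = begin
      nextRow (e′ (suc p)) (nextRow (e′ p) (triangle e′ p)) k
        ≡⟨ nextRow-cong swap₁ (nextRow-cong swap₀ prefix) k ⟩
      nextRow (e p) (nextRow (e (suc p)) (triangle e p)) k
        ≡⟨ nextRow-commute (e (suc p)) (e p) (triangle e p) k ⟩
      nextRow (e (suc p)) (nextRow (e p) (triangle e p)) k ∎
    unchanged : ∀ m → ¬ m ≡ suc p → RowsAgree e′ e m
    unchanged m m≢ with ℕP.<-cmp m (suc p)
    ... | tri< m<p+1 _ _ = triangle-prefix e′ e m (λ i i<m → below i (ℕP.<-≤-trans i<m (ℕP.≤-pred m<p+1)))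
    ... | tri≈ _ m≡p+1 _ = ⊥-elim (m≢ m≡p+1)
    ... | tri> _ _ p+1<m = subst (RowsAgree e′ e) (ℕP.m∸n+n≡m p+1<m)
                                 (triangle-suffix e′ e (suc (suc p)) after-swap above (m ∸ suc (suc p)))

  -- Integer inequalities as natural-number gaps; the row operations above
  -- add natural multiples of rows.
  gap : ∀ {a b : ℤ} → a ≤ b → b ≡ a + + ∣ b - a ∣
  gap {a} {b} a≤b = trans (split a b) (cong (_+_ a) (sym (ℤP.0≤i⇒+∣i∣≡i (ℤP.i≤j⇒0≤j-i a≤b))))
    where
    split : ∀ a b → b ≡ a + (b - a)
    split = solve-∀

  from-gap : ∀ {a b : ℤ} n → b ≡ a + + n → a ≤ b
  from-gap {a} n b≡ = subst (a ≤_) (sym b≡) (ℤP.i≤i+j a (+ n))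

  insertAt : (ℕ → ℤ) → ℕ → ℤ → ℕ → ℤ
  insertAt f q v i with ℕP.<-cmp i q
  ... | tri< _ _ _ = f i
  ... | tri≈ _ _ _ = v
  ... | tri> _ _ _ = f (i ∸ 1)

  insertAt-below : ∀ f q v i → i <ℕ q → insertAt f q v i ≡ f i
  insertAt-below f q v i i<q with ℕP.<-cmp i q
  ... | tri< _ _ _   = refl
  ... | tri≈ _ i≡q _ = ⊥-elim (ℕP.<-irrefl i≡q i<q)
  ... | tri> _ _ q<i = ⊥-elim (ℕP.<-asym i<q q<i)

  insertAt-at : ∀ f q v → insertAt f q v q ≡ v
  insertAt-at f q v with ℕP.<-cmp q q
  ... | tri< q<q _ _ = ⊥-elim (ℕP.<-irrefl refl q<q)
  ... | tri≈ _ _ _   = refl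
  ... | tri> _ _ q<q = ⊥-elim (ℕP.<-irrefl refl q<q)

  insertAt-above : ∀ f q v i → q <ℕ i → insertAt f q v i ≡ f (i ∸ 1)
  insertAt-above f q v i q<i with ℕP.<-cmp i q
  ... | tri< i<q _ _ = ⊥-elim (ℕP.<-asym i<q q<i)
  ... | tri≈ _ i≡q _ = ⊥-elim (ℕP.<-irrefl (sym i≡q) q<i)
  ... | tri> _ _ _   = refl

  -- Moving an inserted value v one position forward past an entry f q ≤ v
  -- is an adjacent exchange that brings the larger value first.
  bubble-step : ∀ N f q v → f q ≤ v →
    TNUpTo N (triangle (insertAt f (suc q) v)) → TNUpTo N (triangle (insertAt f q v))
  bubble-step N f q v fq≤v = TN-swap-adjacent N (insertAt f (suc q) v) (insertAt f q v) q ∣ v - f q ∣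
    (λ i i<q → trans (insertAt-below f q v i i<q) (sym (insertAt-below f (suc q) v i (ℕP.m<n⇒m<1+n i<q))))
    (trans (insertAt-at f q v) (sym (insertAt-at f (suc q) v)))
    (trans (insertAt-above f q v (suc q) (ℕP.n<1+n q)) (sym (insertAt-below f (suc q) v q (ℕP.n<1+n q))))
    (λ i q+2≤i → trans (insertAt-above f q v i (ℕP.<-trans (ℕP.n<1+n q) q+2≤i))
                       (sym (insertAt-above f (suc q) v i q+2≤i)))
    (trans (insertAt-at f (suc q) v)
           (trans (gap fq≤v) (cong (_+ + ∣ v - f q ∣) (sym (insertAt-below f (suc q) v q (ℕP.n<1+n q))))))

  -- Inserting a value v at position s, where v dominates the entries of f at
  -- positions s, ..., N, preserves total non-negativity up to row N + 1:
  -- raise the entry at N to v, then bubble it forward to position s.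
  insert-dominating : ∀ N f v s → s ≤ℕ N → (∀ i → s ≤ℕ i → i ≤ℕ N → f i ≤ v) →
    TNUpTo (suc N) (triangle f) → TNUpTo (suc N) (triangle (insertAt f s v))
  insert-dominating N f v s s≤N dominated = bubble (N ∸ s) s (ℕP.m∸n+n≡m s≤N) dominated
    where
    bubble : ∀ d r → d ℕ.+ r ≡ N → (∀ i → r ≤ℕ i → i ≤ℕ N → f i ≤ v) →
      TNUpTo (suc N) (triangle f) → TNUpTo (suc N) (triangle (insertAt f r v))
    bubble zero r refl dom = TN-raise-last r f (insertAt f r v) ∣ v - f r ∣ (insertAt-below f r v)
      (trans (insertAt-at f r v) (gap (dom r ℕP.≤-refl ℕP.≤-refl)))
    bubble (suc d) r d+r≡N dom tn = bubble-step (suc N) f r v (dom r ℕP.≤-refl r≤N)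
      (bubble d (suc r) (trans (ℕP.+-suc d r) d+r≡N) (λ i r<i i≤N → dom i (ℕP.<⇒≤ r<i) i≤N) tn)
      where
      r≤N : r ≤ℕ N
      r≤N = subst (r ≤ℕ_) d+r≡N (ℕP.m≤n+m r (suc d))

  -- With e_m = -m one step maps row m of the identity to row m + 1:
  -- nextRow (-m) (δ m) k = δ(m, k-1) + (k - m) δ(m, k), and the second term
  -- vanishes since δ(m, k) ≠ 0 only for k = m.
  identity-next-row : ∀ m k → nextRow (+ 0 - + m) (δ m) k ≡ δ (suc m) k
  identity-next-row zero    zero    = refl
  identity-next-row (suc m) zero    = vanish (+ 0 - + suc m + + 0)
    where
    vanish : ∀ x → + 0 + x * + 0 ≡ + 0
    vanish = solve-∀
  identity-next-row m       (suc k) with m ℕP.≟ suc k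
  ... | yes refl = begin
    δ (suc k) k + (+ 0 - + suc k + + suc k) * δ (suc k) (suc k)
      ≡⟨ cong (λ d → δ (suc k) k + (+ 0 - + suc k + + suc k) * d) (δ-diag k) ⟩
    δ (suc k) k + (+ 0 - + suc k + + suc k) * + 1
      ≡⟨ cancel (δ (suc k) k) (+ suc k) ⟩
    δ (suc k) k ∎
    where
    cancel : ∀ d x → d + (+ 0 - x + x) * + 1 ≡ d
    cancel = solve-∀
  ... | no m≢k+1 = begin
    δ m k + (+ 0 - + m + + suc k) * δ m (suc k)  ≡⟨ cong (λ d → δ m k + (+ 0 - + m + + suc k) * d) (δ-off m≢k+1) ⟩
    δ m k + (+ 0 - + m + + suc k) * + 0          ≡⟨ vanish (δ m k) (+ 0 - + m + + suc k) ⟩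
    δ m k                                        ∎
    where
    vanish : ∀ d x → d + x * + 0 ≡ d
    vanish = solve-∀

  triangle-identity : ∀ e → (∀ i → e i ≡ + 0 - + i) → ∀ m k → triangle e m k ≡ δ m k
  triangle-identity e e≡ zero    k = refl
  triangle-identity e e≡ (suc m) k =
    trans (nextRow-cong (e≡ m) (triangle-identity e e≡ m) k) (identity-next-row m k)

  triangle-above-diagonal : ∀ e m k → m <ℕ k → triangle e m k ≡ + 0
  triangle-above-diagonal e zero    k       0<k       = δ-off (λ 0≡k → ℕP.<-irrefl 0≡k 0<k)
  triangle-above-diagonal e (suc m) (suc k) (s≤s m<k) = begin
    triangle e m k + (e m + + suc k) * triangle e m (suc k)
      ≡⟨ cong₂ (λ x y → x + (e m + + suc k) * y) (triangle-above-diagonal e m k m<k)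
                                                   (triangle-above-diagonal e m (suc k) (ℕP.m<n⇒m<1+n m<k)) ⟩
    + 0 + (e m + + suc k) * + 0  ≡⟨ vanish (e m + + suc k) ⟩
    + 0                          ∎
    where
    vanish : ∀ x → + 0 + x * + 0 ≡ + 0
    vanish = solve-∀

  module Staircase (a : ℕ → ℤ) (a₀≥0 : + 0 ≤ a 0) (slow : ∀ i → a i - + 1 ≤ a (suc i)) where

    staircase : ℕ → ℤ → ℕ → ℤ
    staircase j c i with i ℕP.<? j
    ... | yes _ = a i
    ... | no _  = c - + (i ∸ j)

    staircase-below : ∀ j c i → i <ℕ j → staircase j c i ≡ a i
    staircase-below j c i i<j with i ℕP.<? j
    ... | yes _   = refl
    ... | no i≮j  = ⊥-elim (i≮j i<j)

    staircase-from : ∀ j c i → j ≤ℕ i → staircase j c i ≡ c - + (i ∸ j)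
    staircase-from j c i j≤i with i ℕP.<? j
    ... | yes i<j = ⊥-elim (ℕP.<⇒≱ i<j j≤i)
    ... | no _    = refl

    staircase-extend : ∀ j c → a j ≡ c → ∀ i → staircase j c i ≡ staircase (suc j) (c - + 1) i
    staircase-extend j c aj≡c i = by-position (ℕP.<-cmp i j)
      where
      regroup : ∀ c d → c - (+ 1 + d) ≡ (c - + 1) - d
      regroup = solve-∀
      by-position : Tri (i <ℕ j) (i ≡ j) (j <ℕ i) → staircase j c i ≡ staircase (suc j) (c - + 1) i
      by-position (tri< i<j _ _) = trans (staircase-below j c i i<j) (sym (staircase-below (suc j) _ i (ℕP.m<n⇒m<1+n i<j)))
      by-position (tri≈ _ refl _) = begin
        staircase i c i      ≡⟨ staircase-from i c i ℕP.≤-refl ⟩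
        c - + (i ∸ i)        ≡⟨ cong (λ d → c - + d) (ℕP.n∸n≡0 i) ⟩
        c - + 0              ≡⟨ ℤP.+-identityʳ c ⟩
        c                    ≡⟨ sym aj≡c ⟩
        a i                  ≡⟨ sym (staircase-below (suc i) _ i (ℕP.n<1+n i)) ⟩
        staircase (suc i) (c - + 1) i ∎
      by-position (tri> _ _ j<i) = begin
        staircase j c i             ≡⟨ staircase-from j c i (ℕP.<⇒≤ j<i) ⟩
        c - + (i ∸ j)               ≡⟨ cong (λ d → c - + d) (ℕP.+-∸-assoc 1 j<i) ⟩
        c - (+ 1 + + (i ∸ suc j))   ≡⟨ regroup c (+ (i ∸ suc j)) ⟩
        (c - + 1) - + (i ∸ suc j)   ≡⟨ sym (staircase-from (suc j) _ i j<i) ⟩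
        staircase (suc j) (c - + 1) i ∎

    staircase-insert : ∀ j c i → insertAt (staircase j c) j (a j) i ≡ staircase (suc j) c i
    staircase-insert j c i = by-position (ℕP.<-cmp i j)
      where
      by-position : Tri (i <ℕ j) (i ≡ j) (j <ℕ i) → insertAt (staircase j c) j (a j) i ≡ staircase (suc j) c i
      by-position (tri< i<j _ _) = begin
        insertAt (staircase j c) j (a j) i  ≡⟨ insertAt-below _ j _ i i<j ⟩
        staircase j c i                     ≡⟨ staircase-below j c i i<j ⟩
        a i                                 ≡⟨ sym (staircase-below (suc j) c i (ℕP.m<n⇒m<1+n i<j)) ⟩
        staircase (suc j) c i               ∎
      by-position (tri≈ _ refl _) = trans (insertAt-at _ i _) (sym (staircase-below (suc i) c i (ℕP.n<1+n i)))
      by-position (tri> _ _ j<i) = begin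
        insertAt (staircase j c) j (a j) i  ≡⟨ insertAt-above _ j _ i j<i ⟩
        staircase j c (i ∸ 1)               ≡⟨ staircase-from j c (i ∸ 1) (ℕP.∸-monoˡ-≤ 1 j<i) ⟩
        c - + (i ∸ 1 ∸ j)                   ≡⟨ cong (λ d → c - + d) (ℕP.∸-+-assoc i 1 j) ⟩
        c - + (i ∸ suc j)                   ≡⟨ sym (staircase-from (suc j) c i j<i) ⟩
        staircase (suc j) c i               ∎

    Stage : ℕ → ℕ → Set
    Stage N j = Σ ℤ λ c → c ≤ a j × TNUpTo (suc N) (triangle (staircase j c))

    -- Stage 0 is the staircase 0, -1, -2, ..., whose triangle is the identity.
    stage-zero : ∀ N → Stage N zero
    stage-zero N = + 0 , a₀≥0 , λ n rs cs rsInc csInc _ →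
      subst (+ 0 ≤_) (det-cong n _ _ λ i j → sym (triangle-identity _ diagonal (rs i) (cs j)))
            (identity-TN n rs cs rsInc csInc)
      where
      diagonal : ∀ i → staircase 0 (+ 0) i ≡ + 0 - + i
      diagonal i = staircase-from 0 (+ 0) i z≤n

    -- From stage j to stage j + 1: if a_j = c the staircase already has the
    -- right shape; otherwise a_j > c dominates the tail and is inserted.
    stage-suc : ∀ N j → j ≤ℕ N → Stage N j → Stage N (suc j)
    stage-suc N j j≤N (c , c≤aj , tn) with ∣ a j - c ∣ | gap c≤aj
    ... | zero  | aj≡c+0 = c - + 1 , subst (λ x → x - + 1 ≤ a (suc j)) aj≡c (slow j) ,
          TN-prefix (suc N) _ _ (λ i _ → staircase-extend j c aj≡c i) tn
      where
      aj≡c : a j ≡ c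
      aj≡c = trans aj≡c+0 (ℤP.+-identityʳ c)
    ... | suc g | aj≡c+g+1 = c , ℤP.≤-trans (from-gap g (drop-one aj≡c+g+1)) (slow j) ,
          TN-prefix (suc N) _ _ (λ i _ → staircase-insert j c i)
            (insert-dominating N (staircase j c) (a j) j j≤N dominated tn)
      where
      drop-one : ∀ {x} → x ≡ c + + suc g → x - + 1 ≡ c + + g
      drop-one refl = cancel c (+ g)
        where
        cancel : ∀ c g → c + (+ 1 + g) - + 1 ≡ c + g
        cancel = solve-∀
      dominated : ∀ i → j ≤ℕ i → i ≤ℕ N → staircase j c i ≤ a j
      dominated i j≤i _ = subst (_≤ a j) (sym (staircase-from j c i j≤i)) (ℤP.i≤j⇒i-k≤j (+ (i ∸ j)) c≤aj)

    stage : ∀ N j → j ≤ℕ suc N → Stage N j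
    stage N zero    _     = stage-zero N
    stage N (suc j) j<N+1 = stage-suc N j (ℕP.≤-pred j<N+1) (stage N j (ℕP.<⇒≤ j<N+1))

    -- Stage N + 1 agrees with a on all parameters that rows ≤ N + 1 see.
    triangle-TN : TotallyNonNegative (triangle a)
    triangle-TN = TN-from-bounded (triangle a) λ N →
      let (c , _ , tn) = stage N (suc N) ℕP.≤-refl
      in TN-prefix (suc N) _ a (staircase-below (suc N) c) tn


module Counting where
  open import Data.Nat using (ℕ; suc; _+_; _∸_; _<_)
  import Data.Nat.Properties as ℕP
  open import Data.List using (List; []; _∷_; map; filter; length; _++_; upTo)
  import Data.List.Properties as LP
  open import Data.List.Relation.Unary.All as All using (All; []; _∷_)
  open import Data.List.Relation.Unary.AllPairs using (_∷_)
  open import Data.List.Relation.Unary.Any using (here; there)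
  open import Data.List.Relation.Unary.Unique.DecPropositional ℕP._≟_ using (Unique)
  import Data.List.Relation.Unary.Unique.Propositional.Properties as UniqueP
  open import Data.List.Membership.Propositional using (_∈_)
  import Data.List.Membership.Propositional.Properties as MembershipP
  open import Data.Product using (_,_; proj₂)
  open import Relation.Nullary using (yes; no; ¬_; Dec; ¬?)
  open import Relation.Nullary.Decidable using (_×-dec_)
  open import Relation.Binary.PropositionalEquality
  open ≡-Reasoning

  module _ {A : Set} where

    count : ∀ {P : A → Set} → (∀ x → Dec (P x)) → List A → ℕ
    count P? xs = length (filter P? xs)

    count-++ : ∀ {P : A → Set} (P? : ∀ x → Dec (P x)) xs ys → count P? (xs ++ ys) ≡ count P? xs + count P? ys
    count-++ P? xs ys = trans (cong length (LP.filter-++ P? xs ys)) (LP.length-++ (filter P? xs))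

    count-cong : ∀ {P Q : A → Set} (P? : ∀ x → Dec (P x)) (Q? : ∀ x → Dec (Q x)) →
      (∀ {x} → P x → Q x) → (∀ {x} → Q x → P x) → ∀ xs → count P? xs ≡ count Q? xs
    count-cong P? Q? P⇒Q Q⇒P xs = cong length (LP.filter-≐ P? Q? (P⇒Q , Q⇒P) xs)

    count-none : ∀ {P : A → Set} (P? : ∀ x → Dec (P x)) {xs} → All (λ x → ¬ P x) xs → count P? xs ≡ 0
    count-none P? none = cong length (LP.filter-none P? none)

    count-accept : ∀ {P : A → Set} (P? : ∀ x → Dec (P x)) {x xs} → P x → count P? (x ∷ xs) ≡ suc (count P? xs)
    count-accept P? p = cong length (LP.filter-accept P? p)

    count-reject : ∀ {P : A → Set} (P? : ∀ x → Dec (P x)) {x xs} → ¬ P x → count P? (x ∷ xs) ≡ count P? xs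
    count-reject P? ¬p = cong length (LP.filter-reject P? ¬p)

    count-all : ∀ {P : A → Set} (P? : ∀ x → Dec (P x)) → (∀ x → P x) → ∀ xs → count P? xs ≡ length xs
    count-all P? all xs = cong length (LP.filter-all P? (All.universal all xs))

    count-split : ∀ {P Q : A → Set} (P? : ∀ x → Dec (P x)) (Q? : ∀ x → Dec (Q x)) xs →
      count P? xs ≡ count (λ x → P? x ×-dec ¬? (Q? x)) xs + count (λ x → P? x ×-dec Q? x) xs
    count-split P? Q? [] = refl
    count-split P? Q? (x ∷ xs) with P? x | Q? x
    ... | yes _ | yes _ = trans (cong suc (count-split P? Q? xs)) (sym (ℕP.+-suc _ _))
    ... | yes _ | no _  = cong suc (count-split P? Q? xs)
    ... | no _  | _     = count-split P? Q? xs

  count-map : ∀ {A B : Set} {P : B → Set} (P? : ∀ x → Dec (P x)) (g : A → B) xs →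
    count P? (map g xs) ≡ count (λ x → P? (g x)) xs
  count-map P? g [] = refl
  count-map P? g (x ∷ xs) with P? (g x)
  ... | yes _ = cong suc (count-map P? g xs)
  ... | no _  = count-map P? g xs

  count-occurrences : ∀ (xs : List ℕ) x → Unique xs → x ∈ xs → count (ℕP._≟ x) xs ≡ 1
  count-occurrences (y ∷ ys) x (y∉ys ∷ _) (here refl) =
    trans (count-accept (ℕP._≟ x) refl)
          (cong suc (count-none (ℕP._≟ x) (All.map (λ x≢z z≡x → x≢z (sym z≡x)) y∉ys)))
  count-occurrences (y ∷ ys) x (y∉ys ∷ u) (there x∈ys) =
    trans (count-reject (ℕP._≟ x) (All.lookup y∉ys x∈ys)) (count-occurrences ys x u x∈ys)

  Fresh? : (L : List ℕ) (r : ℕ) → Dec (All (λ y → ¬ r ≡ y) L)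
  Fresh? L r = All.all? (λ y → ¬? (r ℕP.≟ y)) L

  free-rows : ∀ h (L : List ℕ) → Unique L → All (_< h) L → count (Fresh? L) (upTo h) ≡ h ∸ length L
  free-rows h []      _           _               = trans (count-all (Fresh? []) (λ _ → []) (upTo h)) (LP.length-upTo h)
  free-rows h (x ∷ L) (x∉L ∷ u) (x<h ∷ bounded) = begin
    count (Fresh? (x ∷ L)) (upTo h)          ≡⟨ ℕP.m+n∸n≡m _ 1 ⟨
    count (Fresh? (x ∷ L)) (upTo h) + 1 ∸ 1  ≡⟨ cong (_∸ 1) remove-x ⟨
    count (Fresh? L) (upTo h) ∸ 1            ≡⟨ cong (_∸ 1) (free-rows h L u bounded) ⟩
    h ∸ length L ∸ 1                         ≡⟨ ℕP.∸-+-assoc h (length L) 1 ⟩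
    h ∸ (length L + 1)                       ≡⟨ cong (h ∸_) (ℕP.+-comm (length L) 1) ⟩
    h ∸ suc (length L)                       ∎
    where
    avoid-x : count (λ r → Fresh? L r ×-dec ¬? (r ℕP.≟ x)) (upTo h) ≡ count (Fresh? (x ∷ L)) (upTo h)
    avoid-x = count-cong _ _ (λ (fresh , r≢x) → r≢x ∷ fresh) (λ { (r≢x ∷ fresh) → fresh , r≢x }) (upTo h)
    hit-x : count (λ r → Fresh? L r ×-dec (r ℕP.≟ x)) (upTo h) ≡ 1
    hit-x = trans (count-cong _ (ℕP._≟ x) proj₂ (λ { refl → x∉L , refl }) (upTo h))
                  (count-occurrences (upTo h) x (UniqueP.upTo⁺ h) (MembershipP.∈-upTo⁺ x<h))
    -- the values fresh for L are those fresh for x ∷ L, plus x itself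
    remove-x : count (Fresh? L) (upTo h) ≡ count (Fresh? (x ∷ L)) (upTo h) + 1
    remove-x = trans (count-split (Fresh? L) (ℕP._≟ x) (upTo h)) (cong₂ _+_ avoid-x hit-x)

module RookNumbers where
  open Counting
  open import Data.Nat using (ℕ; zero; suc; _+_; _*_; _∸_; _<_; _≤_)
  import Data.Nat.Properties as ℕP
  open import Data.Nat.Tactic.RingSolver using (solve-∀)
  open import Data.Maybe using (Maybe; just; nothing)
  open import Data.List using (List; []; _∷_; _++_; map; concatMap; upTo; length; catMaybes)
  open import Data.List.Relation.Unary.All as All using (All; []; _∷_)
  import Data.List.Relation.Unary.All.Properties as AllP
  open import Data.List.Relation.Unary.AllPairs using (_∷_)
  open import Data.List.Relation.Unary.Unique.DecPropositional ℕP._≟_ using (unique?)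
  import Data.List.Membership.Propositional.Properties as MembershipP
  open import Data.Product using (_,_; proj₁)
  open import Data.Sum using (inj₁; inj₂)
  open import Relation.Nullary using (yes; no; Dec)
  open import Relation.Nullary.Decidable using (_×-dec_)
  open import Relation.Binary.PropositionalEquality
  open ≡-Reasoning

  placement? : (k : ℕ) (a : List (Maybe ℕ)) → Dec (IsRookPlacement k a)
  placement? k a = (length (catMaybes a) ℕP.≟ k) ×-dec unique? (catMaybes a)

  extensions : ℕ → List (Maybe ℕ) → List (List (Maybe ℕ))
  extensions h a = map (_∷ a) (columnOptions h)

  rows-bounded : ∀ b m B → (∀ i → i < m → b i ≤ B) → All (λ a → All (_< B) (catMaybes a)) (assignments b m)
  rows-bounded b zero    B _       = [] ∷ []
  rows-bounded b (suc m) B heights = AllP.concat⁺ (AllP.map⁺ (All.map extend (rows-bounded b m B earlier)))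
    where
    earlier : ∀ i → i < m → b i ≤ B
    earlier i i<m = heights i (ℕP.m<n⇒m<1+n i<m)
    extend : ∀ {a} → All (_< B) (catMaybes a) → All (λ a → All (_< B) (catMaybes a)) (extensions (b m) a)
    extend rows = rows ∷ AllP.map⁺ (AllP.map⁺ (All.tabulate λ r∈ →
      ℕP.<-≤-trans (MembershipP.∈-upTo⁻ r∈) (heights m (ℕP.n<1+n m)) ∷ rows))

  count-extensions : ∀ k h a → count (placement? k) (extensions h a) ≡
    count (placement? k) (a ∷ []) + count (λ r → placement? k (just r ∷ a)) (upTo h)
  count-extensions k h a =
    trans (count-++ (placement? k) ((nothing ∷ a) ∷ []) (map (_∷ a) (map just (upTo h))))
          (cong₂ _+_ (count-map (placement? k) (nothing ∷_) (a ∷ []))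
                     (trans (count-map (placement? k) (_∷ a) (map just (upTo h)))
                            (count-map (λ o → placement? k (o ∷ a)) just (upTo h))))

  new-rook : ∀ k h a → All (_< h) (catMaybes a) → Dec (IsRookPlacement k a) →
    count (λ r → placement? (suc k) (just r ∷ a)) (upTo h) ≡ (h ∸ k) * count (placement? k) (a ∷ [])
  new-rook k h a bounded (yes (length≡k , distinct)) = begin
    count (λ r → placement? (suc k) (just r ∷ a)) (upTo h)
      ≡⟨ count-cong _ (Fresh? (catMaybes a)) (λ { (_ , (fresh ∷ _)) → fresh })
                    (λ fresh → cong suc length≡k , fresh ∷ distinct) (upTo h) ⟩
    count (Fresh? (catMaybes a)) (upTo h)  ≡⟨ free-rows h (catMaybes a) distinct bounded ⟩
    h ∸ length (catMaybes a)               ≡⟨ cong (h ∸_) length≡k ⟩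
    h ∸ k                                  ≡⟨ ℕP.*-identityʳ (h ∸ k) ⟨
    (h ∸ k) * 1
      ≡⟨ cong ((h ∸ k) *_) (count-accept (placement? k) {a} {[]} (length≡k , distinct)) ⟨
    (h ∸ k) * count (placement? k) (a ∷ []) ∎
  new-rook k h a bounded (no ¬placement) = begin
    count (λ r → placement? (suc k) (just r ∷ a)) (upTo h)
      ≡⟨ count-none _ (All.universal (λ { r (length≡ , (_ ∷ distinct)) →
                                            ¬placement (ℕP.suc-injective length≡ , distinct) }) (upTo h)) ⟩
    0                                       ≡⟨ ℕP.*-zeroʳ (h ∸ k) ⟨
    (h ∸ k) * 0                             ≡⟨ cong ((h ∸ k) *_) (count-reject (placement? k) {a} {[]} ¬placement) ⟨
    (h ∸ k) * count (placement? k) (a ∷ []) ∎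

  extensions-zero : ∀ h a → count (placement? 0) (extensions h a) ≡ count (placement? 0) (a ∷ [])
  extensions-zero h a = begin
    count (placement? 0) (extensions h a)
      ≡⟨ count-extensions 0 h a ⟩
    count (placement? 0) (a ∷ []) + count (λ r → placement? 0 (just r ∷ a)) (upTo h)
      ≡⟨ cong (count (placement? 0) (a ∷ []) +_)
              (count-none _ (All.universal (λ r placed → ℕP.1+n≢0 (proj₁ placed)) (upTo h))) ⟩
    count (placement? 0) (a ∷ []) + 0
      ≡⟨ ℕP.+-identityʳ _ ⟩
    count (placement? 0) (a ∷ []) ∎

  extensions-suc : ∀ h k a → All (_< h) (catMaybes a) →
    count (placement? (suc k)) (extensions h a) ≡
    count (placement? (suc k)) (a ∷ []) + (h ∸ k) * count (placement? k) (a ∷ [])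
  extensions-suc h k a bounded = trans (count-extensions (suc k) h a)
    (cong (count (placement? (suc k)) (a ∷ []) +_) (new-rook k h a bounded (placement? k a)))

  count-all-extensions-zero : ∀ h xs → count (placement? 0) (concatMap (extensions h) xs) ≡ count (placement? 0) xs
  count-all-extensions-zero h []       = refl
  count-all-extensions-zero h (a ∷ xs) = begin
    count (placement? 0) (extensions h a ++ concatMap (extensions h) xs)
      ≡⟨ count-++ (placement? 0) (extensions h a) _ ⟩
    count (placement? 0) (extensions h a) + count (placement? 0) (concatMap (extensions h) xs)
      ≡⟨ cong₂ _+_ (extensions-zero h a) (count-all-extensions-zero h xs) ⟩
    count (placement? 0) (a ∷ []) + count (placement? 0) xs
      ≡⟨ count-++ (placement? 0) (a ∷ []) xs ⟨
    count (placement? 0) (a ∷ xs) ∎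

  count-all-extensions-suc : ∀ h k xs → All (λ a → All (_< h) (catMaybes a)) xs →
    count (placement? (suc k)) (concatMap (extensions h) xs) ≡
    count (placement? (suc k)) xs + (h ∸ k) * count (placement? k) xs
  count-all-extensions-suc h k []       _                 = sym (ℕP.*-zeroʳ (h ∸ k))
  count-all-extensions-suc h k (a ∷ xs) (bounded ∷ rest) = begin
    count P′ (extensions h a ++ concatMap (extensions h) xs)
      ≡⟨ count-++ P′ (extensions h a) _ ⟩
    count P′ (extensions h a) + count P′ (concatMap (extensions h) xs)
      ≡⟨ cong₂ _+_ (extensions-suc h k a bounded) (count-all-extensions-suc h k xs rest) ⟩
    (count P′ (a ∷ []) + (h ∸ k) * count P (a ∷ [])) + (count P′ xs + (h ∸ k) * count P xs)
      ≡⟨ regroup (count P′ (a ∷ [])) (count P (a ∷ [])) (count P′ xs) (count P xs) (h ∸ k) ⟩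
    (count P′ (a ∷ []) + count P′ xs) + (h ∸ k) * (count P (a ∷ []) + count P xs)
      ≡⟨ cong₂ (λ u v → u + (h ∸ k) * v) (count-++ P′ (a ∷ []) xs) (count-++ P (a ∷ []) xs) ⟨
    count P′ (a ∷ xs) + (h ∸ k) * count P (a ∷ xs) ∎
    where
    P : (a : List (Maybe ℕ)) → Dec (IsRookPlacement k a)
    P = placement? k
    P′ : (a : List (Maybe ℕ)) → Dec (IsRookPlacement (suc k) a)
    P′ = placement? (suc k)
    regroup : ∀ x y x′ y′ c → (x + c * y) + (x′ + c * y′) ≡ (x + x′) + c * (y + y′)
    regroup = solve-∀

  module Recurrences (b : ℕ → ℕ) (nondecreasing : ∀ i → b i ≤ b (suc i)) where

    heights-mono : ∀ i m → i ≤ m → b i ≤ b m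
    heights-mono i zero    i≤0   = ℕP.≤-reflexive (cong b (ℕP.n≤0⇒n≡0 i≤0))
    heights-mono i (suc m) i≤m+1 with ℕP.m≤n⇒m<n∨m≡n i≤m+1
    ... | inj₁ i<m+1  = ℕP.≤-trans (heights-mono i m (ℕP.≤-pred i<m+1)) (nondecreasing m)
    ... | inj₂ i≡m+1  = ℕP.≤-reflexive (cong b i≡m+1)

    -- R_0(B_m) = 1 and R_{k+1}(B_{m+1}) = R_{k+1}(B_m) + (b_m - k) R_k(B_m);
    -- the latter needs all rows of B_m to be rows of B_{m+1}, i.e. monotonicity.
    R-zero : ∀ m → R b m 0 ≡ 1
    R-zero zero    = refl
    R-zero (suc m) = trans (count-all-extensions-zero (b m) (assignments b m)) (R-zero m)

    R-suc : ∀ m k → R b (suc m) (suc k) ≡ R b m (suc k) + (b m ∸ k) * R b m k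
    R-suc m k = count-all-extensions-suc (b m) k (assignments b m)
      (rows-bounded b m (b m) (λ i i<m → heights-mono i m (ℕP.<⇒≤ i<m)))


open import Data.Nat using (ℕ; suc; _≤_)

module RookTriangle (b : ℕ → ℕ) (nondecreasing : ∀ i → b i ≤ b (suc i)) where
  open BoundedMinors using (δ; δ-off)
  open RecursiveTriangle
  open RookNumbers.Recurrences b nondecreasing
  import Data.Nat as ℕ
  import Data.Nat.Properties as ℕP
  open import Data.Nat using (zero; s≤s; _∸_; _≤?_) renaming (_≤_ to _≤ℕ_; _<_ to _<ℕ_)
  open import Data.Integer using (ℤ; +_; _+_; _*_; _-_) renaming (_≤_ to _≤ℤ_)
  import Data.Integer.Properties as ℤP
  open import Data.Integer.Tactic.RingSolver using (solve-∀)
  open import Data.Sum using (inj₁; inj₂)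
  open import Relation.Nullary using (yes; no)
  open import Relation.Binary.PropositionalEquality
  open ≡-Reasoning

  R-more-than-columns : ∀ m j → m <ℕ j → R b m j ≡ 0
  R-more-than-columns zero    (suc j) _         = refl
  R-more-than-columns (suc m) (suc j) (s≤s m<j) = begin
    R b (suc m) (suc j)                      ≡⟨ R-suc m j ⟩
    R b m (suc j) ℕ.+ (b m ∸ j) ℕ.* R b m j  ≡⟨ cong₂ (λ x y → x ℕ.+ (b m ∸ j) ℕ.* y)
                                                       (R-more-than-columns m (suc j) (ℕP.m<n⇒m<1+n m<j))
                                                       (R-more-than-columns m j m<j) ⟩
    (b m ∸ j) ℕ.* 0                          ≡⟨ ℕP.*-zeroʳ (b m ∸ j) ⟩
    0                                        ∎

  R-more-than-rows : ∀ m j → b m <ℕ j → R b m j ≡ 0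
  R-more-than-rows zero    (suc j) _     = refl
  R-more-than-rows (suc m) (suc j) bm+1≤j = begin
    R b (suc m) (suc j)                      ≡⟨ R-suc m j ⟩
    R b m (suc j) ℕ.+ (b m ∸ j) ℕ.* R b m j  ≡⟨ cong₂ (λ x y → x ℕ.+ y ℕ.* R b m j)
                                                       (R-more-than-rows m (suc j) (ℕP.≤-<-trans (nondecreasing m) bm+1≤j))
                                                       (ℕP.m≤n⇒m∸n≡0 (ℕP.≤-trans (nondecreasing m) (ℕP.≤-pred bm+1≤j))) ⟩
    0                                        ∎

  pos-∸ : ∀ {m n} → n ≤ℕ m → + (m ∸ n) ≡ + m - + n
  pos-∸ {m} {n} n≤m = trans (sym (ℤP.⊖-≥ n≤m)) (sym (ℤP.m-n≡m⊖n m n))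

  a : ℕ → ℤ
  a i = + b i - + i

  -- The weight (b_m - j)₊ of the recurrence may be replaced by the integer
  -- b_m - j = a_m + k (for j = m - k): when j > b_m, R_j(B_m) vanishes anyway.
  weight : ∀ m j k → j ℕ.+ k ≡ m → + ((b m ∸ j) ℕ.* R b m j) ≡ (a m + + k) * + R b m j
  weight m j k j+k≡m with j ℕP.≤? b m
  ... | yes j≤bm = begin
    + ((b m ∸ j) ℕ.* R b m j)      ≡⟨ ℤP.pos-* (b m ∸ j) (R b m j) ⟩
    + (b m ∸ j) * + R b m j        ≡⟨ cong (_* + R b m j) (pos-∸ j≤bm) ⟩
    (+ b m - + j) * + R b m j      ≡⟨ cong (_* + R b m j) (shift-by-k (+ b m) (+ j) (+ k)) ⟩
    (+ b m - + (j ℕ.+ k) + + k) * + R b m j  ≡⟨ cong (λ n → (+ b m - + n + + k) * + R b m j) j+k≡m ⟩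
    (a m + + k) * + R b m j        ∎
    where
    shift-by-k : ∀ B J K → B - J ≡ B - (J + K) + K
    shift-by-k = solve-∀
  ... | no j≰bm = begin
    + ((b m ∸ j) ℕ.* R b m j)      ≡⟨ cong (λ r → + ((b m ∸ j) ℕ.* r)) vanishes ⟩
    + ((b m ∸ j) ℕ.* 0)            ≡⟨ cong +_ (ℕP.*-zeroʳ (b m ∸ j)) ⟩
    + 0                            ≡⟨ ℤP.*-zeroʳ (a m + + k) ⟨
    (a m + + k) * + 0              ≡⟨ cong (λ r → (a m + + k) * + r) vanishes ⟨
    (a m + + k) * + R b m j        ∎
    where
    vanishes : R b m j ≡ 0
    vanishes = R-more-than-rows m j (ℕP.≰⇒> j≰bm)

  -- The entries R_{m-k}(B_m) on and below the diagonal satisfy the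
  -- recurrence of T_a, since (b_m - (m - k)) = a_m + k.
  rook-triangle : ∀ m k → k ≤ℕ m → + R b m (m ∸ k) ≡ triangle a m k
  rook-triangle zero    zero _     = refl
  rook-triangle (suc m) k    k≤m+1 with ℕP.m≤n⇒m<n∨m≡n k≤m+1
  ... | inj₂ refl = begin
    + R b (suc m) (m ∸ m)              ≡⟨ cong (λ j → + R b (suc m) j) (ℕP.n∸n≡0 m) ⟩
    + R b (suc m) 0                    ≡⟨ cong +_ (R-zero (suc m)) ⟩
    + 1                                ≡⟨ vanish (a m + + suc m) ⟨
    + 1 + (a m + + suc m) * + 0        ≡⟨ cong₂ (λ x y → x + (a m + + suc m) * y) diagonal
                                                (sym (triangle-above-diagonal a m (suc m) (ℕP.n<1+n m))) ⟩
    triangle a (suc m) (suc m)         ∎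
    where
    vanish : ∀ x → + 1 + x * + 0 ≡ + 1
    vanish = solve-∀
    diagonal : + 1 ≡ triangle a m m
    diagonal = begin
      + 1              ≡⟨ cong +_ (R-zero m) ⟨
      + R b m 0        ≡⟨ cong (λ j → + R b m j) (ℕP.n∸n≡0 m) ⟨
      + R b m (m ∸ m)  ≡⟨ rook-triangle m m ℕP.≤-refl ⟩
      triangle a m m   ∎
  ... | inj₁ (s≤s k≤m) = begin
    + R b (suc m) (suc m ∸ k)
      ≡⟨ cong (λ j → + R b (suc m) j) (ℕP.+-∸-assoc 1 k≤m) ⟩
    + R b (suc m) (suc j)
      ≡⟨ cong +_ (R-suc m j) ⟩
    + (R b m (suc j) ℕ.+ (b m ∸ j) ℕ.* R b m j)
      ≡⟨ ℤP.pos-+ (R b m (suc j)) _ ⟩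
    + R b m (suc j) + + ((b m ∸ j) ℕ.* R b m j)
      ≡⟨ cong₂ _+_ (shifted k k≤m) (weight m j k (ℕP.m∸n+n≡m k≤m)) ⟩
    shift (triangle a m) k + (a m + + k) * + R b m j
      ≡⟨ cong (λ x → shift (triangle a m) k + (a m + + k) * x) (rook-triangle m k k≤m) ⟩
    triangle a (suc m) k ∎
    where
    j = m ∸ k
    shifted : ∀ k → k ≤ℕ m → + R b m (suc (m ∸ k)) ≡ shift (triangle a m) k
    shifted zero     _        = cong +_ (R-more-than-columns m (suc m) (ℕP.n<1+n m))
    shifted (suc k′) k′<m = trans (cong (λ j → + R b m j) (sym (ℕP.+-∸-assoc 1 k′<m)))
                                 (rook-triangle m k′ (ℕP.<⇒≤ k′<m))

  rookMatrix≡triangle : ∀ m k → rookMatrix b m k ≡ triangle a m k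
  rookMatrix≡triangle m k with k ≤? m
  ... | yes k≤m = rook-triangle m k k≤m
  ... | no k≰m  = sym (triangle-above-diagonal a m k (ℕP.≰⇒> k≰m))

  -- The hypotheses of the staircase argument: a_0 = b_0 ≥ 0, and
  -- a_{i+1} - (a_i - 1) = b_{i+1} - b_i ≥ 0.
  a₀≥0 : + 0 ≤ℤ a 0
  a₀≥0 = from-gap (b 0) (ℤP.+-identityʳ (+ b 0))

  slow : ∀ i → a i - + 1 ≤ℤ a (suc i)
  slow i = from-gap (b (suc i) ∸ b i) (begin
    + b (suc i) - + suc i
      ≡⟨ regroup (+ b (suc i)) (+ b i) (+ i) ⟩
    (+ b i - + i - + 1) + (+ b (suc i) - + b i)
      ≡⟨ cong (_+_ (a i - + 1)) (sym (pos-∸ (nondecreasing i))) ⟩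
    (a i - + 1) + + (b (suc i) ∸ b i) ∎)
    where
    regroup : ∀ B′ B I → B′ - (+ 1 + I) ≡ (B - I - + 1) + (B′ - B)
    regroup = solve-∀

corollary1p3 : (b : ℕ → ℕ) → (∀ i → 1 ≤ b i) → (∀ i → b i ≤ b (suc i)) →
    TotallyNonNegative (rookMatrix b)
corollary1p3 b _ nondecreasing =
  TN-cong (RecursiveTriangle.triangle a) (rookMatrix b) (λ m k → sym (rookMatrix≡triangle m k))
    (RecursiveTriangle.Staircase.triangle-TN a a₀≥0 slow)
  where
  open RookTriangle b nondecreasing
  open BoundedMinors using (TN-cong)
  open import Relation.Binary.PropositionalEquality using (sym)
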